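{- No deterministic incremental matching-based online algorithm for vertex cover achieves a competitive ratio smaller than $2-\frac{2}{\mathrm{OPT}}$; that is, for every such algorithm there are instances (with arbitrarily large $\mathrm{OPT}$) on which the size of its vertex cover is at least $\left(2-\frac{2}{\mathrm{OPT}}\right)\mathrm{OPT}$, where $\mathrm{OPT}$ is the minimum vertex cover size of the instance.
   Context: Online vertex cover (vertex-arrival): vertices of an unknown graph arrive one at a time with their edges to previously revealed vertices; the algorithm maintains a set of accepted vertices covering all revealed edges and may change vertices' statuses later. An online algorithm for vertex cover is incremental matching-based if it maintains a maximal matching of the revealed graph throughout the process in an incremental manner (matching edges are only added, never removed), and its solution only contains vertices saturated by this matching. -}

module Defs where

open import Data.Nat using (ℕ; zero; suc; _+_; _*_; _≤_)
open import Data.Fin using (Fin; toℕ)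
open import Data.Bool using (Bool; true; false; if_then_else_)
open import Data.List using (List)
open import Data.List.Membership.Propositional using (_∈_)
open import Data.Product using (_×_; _,_; Σ; ∃)
open import Data.Sum using (_⊎_)
open import Relation.Binary.PropositionalEquality using (_≡_)

-- A revealed graph, given by its arrival history (vertex-arrival model).
-- Vertices are 0, 1, ..., n-1 in order of arrival; vertex n (the one added
-- by  h ▸ N ) arrives together with the list N of its neighbours among the
-- previously revealed vertices (repetitions in N are harmless).
data History : ℕ → Set where
  ε   : History 0
  _▸_ : ∀ {n} → History n → List (Fin n) → History (suc n)

infixl 5 _▸_

-- Edge h u v : {u , v} is an edge of the revealed graph, with u < v
-- (u arrived earlier than v).
data Edge : ∀ {n} → History n → ℕ → ℕ → Set where
  old : ∀ {n} {h : History n} {N : List (Fin n)} {u v : ℕ} →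
        Edge h u v → Edge (h ▸ N) u v
  new : ∀ {n} {h : History n} {N : List (Fin n)} (i : Fin n) →
        i ∈ N → Edge (h ▸ N) (toℕ i) n

count : (ℕ → Bool) → ℕ → ℕ
count S zero    = zero
count S (suc n) = count S n + (if S n then 1 else 0)

IsVertexCover : ∀ {n} → History n → (ℕ → Bool) → Set
IsVertexCover h C = ∀ u v → Edge h u v → (C u ≡ true) ⊎ (C v ≡ true)

IsMinVCSize : ∀ {n} → History n → ℕ → Set
IsMinVCSize {n} h k =
  (Σ (ℕ → Bool) λ C → IsVertexCover h C × count C n ≡ k) ×
  (∀ C → IsVertexCover h C → k ≤ count C n)

-- Matchings, represented as lists of edges (u , v) with u < v.
Incident : ℕ → ℕ × ℕ → Set
Incident w (u , v) = (w ≡ u) ⊎ (w ≡ v)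

Saturated : List (ℕ × ℕ) → ℕ → Set
Saturated M w = ∃ λ e → e ∈ M × Incident w e

IsMatching : ∀ {n} → History n → List (ℕ × ℕ) → Set
IsMatching h M =
  (∀ u v → (u , v) ∈ M → Edge h u v) ×
  (∀ e e' w → e ∈ M → e' ∈ M → Incident w e → Incident w e' → e ≡ e')

IsMaximalMatching : ∀ {n} → History n → List (ℕ × ℕ) → Set
IsMaximalMatching h M =
  IsMatching h M × (∀ u v → Edge h u v → Saturated M u ⊎ Saturated M v)

-- A deterministic online algorithm: after each arrival its state (the
-- current matching and the current solution) is a function of the revealed
-- history only.  The solution may change arbitrarily between steps.
record OnlineAlgorithm : Set where
  field
    matching : ∀ {n} → History n → List (ℕ × ℕ)
    solution : ∀ {n} → History n → ℕ → Bool

record IncrementalMatchingBased (A : OnlineAlgorithm) : Set where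
  open OnlineAlgorithm A
  field
    maximal     : ∀ {n} (h : History n) → IsMaximalMatching h (matching h)
    incremental : ∀ {n} (h : History n) (N : List (Fin n)) (e : ℕ × ℕ) →
                  e ∈ matching h → e ∈ matching (h ▸ N)
    covers      : ∀ {n} (h : History n) → IsVertexCover h (solution h)
    saturatedOnly : ∀ {n} (h : History n) (w : ℕ) →
                    solution h w ≡ true → Saturated (matching h) w

-- Reveal m disjoint edges {2j, 2j+1} one vertex at a time.  A maximal matching
-- of this graph must consist of all m edges, and an incremental algorithm keeps
-- them.  Then reveal a centre w adjacent to all 2m earlier vertices: they are
-- all saturated, so w stays unsaturated, a matching-based solution must leave w
-- out and hence contain all 2m neighbours.  Yet the left endpoints together
-- with w form a cover of size m + 1, which is optimal, so the algorithm pays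
-- 2m = 2 OPT - 2.
module Submission where

open import Defs
open import Data.Nat using (ℕ; zero; suc; _+_; _*_; _≤_; _<_; s≤s; z≤n; ⌊_/2⌋)
open import Data.Nat.Properties
open import Data.Product using (Σ; _×_; _,_; proj₁; proj₂)
open import Data.Sum using (_⊎_; inj₁; inj₂; [_,_]′)
open import Data.Bool using (Bool; true; false; if_then_else_)
open import Data.Fin using (toℕ; fromℕ; fromℕ<)
open import Data.Fin.Properties using (toℕ-fromℕ; toℕ-fromℕ<; toℕ<n)
open import Data.List using ([]; _∷_; allFin)
open import Data.List.Membership.Propositional using (_∈_)
open import Data.List.Membership.Propositional.Properties using (∈-allFin)
open import Data.List.Relation.Unary.Any using (here)
open import Function using (id)
open import Relation.Nullary using (¬_; contradiction)
open import Relation.Binary.PropositionalEquality using (_≡_; _≢_; refl; sym; trans; cong; subst)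

left : ℕ → ℕ
left zero    = zero
left (suc j) = suc (suc (left j))

right : ℕ → ℕ
right j = suc (left j)

even : ℕ → Bool
even zero          = true
even (suc zero)    = false
even (suc (suc x)) = even x

even-left : ∀ j → even (left j) ≡ true
even-left zero    = refl
even-left (suc j) = even-left j

even-right : ∀ j → even (right j) ≡ false
even-right zero    = refl
even-right (suc j) = even-right j

⌊left/2⌋ : ∀ j → ⌊ left j /2⌋ ≡ j
⌊left/2⌋ zero    = refl
⌊left/2⌋ (suc j) = cong suc (⌊left/2⌋ j)

⌊right/2⌋ : ∀ j → ⌊ right j /2⌋ ≡ j
⌊right/2⌋ zero    = refl
⌊right/2⌋ (suc j) = cong suc (⌊right/2⌋ j)

left≡2* : ∀ j → left j ≡ 2 * j
left≡2* zero    = refl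
left≡2* (suc j) = trans (cong (2 +_) (left≡2* j)) (sym (*-suc 2 j))

n≤left : ∀ n → n ≤ left n
n≤left zero    = z≤n
n≤left (suc n) = s≤s (m≤n⇒m≤1+n (n≤left n))

incident-pair-index : ∀ {x j} → Incident x (left j , right j) → ⌊ x /2⌋ ≡ j
incident-pair-index {j = j} (inj₁ refl) = ⌊left/2⌋ j
incident-pair-index {j = j} (inj₂ refl) = ⌊right/2⌋ j

incident-pair-unique : ∀ {x i j} → Incident x (left i , right i) →
                       Incident x (left j , right j) → i ≡ j
incident-pair-unique p q = trans (sym (incident-pair-index p)) (incident-pair-index q)

count-all : ∀ S n → (∀ x → x < n → S x ≡ true) → count S n ≡ n
count-all S zero    all = refl
count-all S (suc n) all
  rewrite all n ≤-refl | count-all S n (λ x x<n → all x (m<n⇒m<1+n x<n)) = +-comm n 1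

count-≤-suc : ∀ S n → count S n ≤ count S (suc n)
count-≤-suc S n = m≤m+n (count S n) _

indicator-pair : ∀ {a b} → a ≡ true ⊎ b ≡ true →
                 1 ≤ (if a then 1 else 0) + (if b then 1 else 0)
indicator-pair {true}          _        = s≤s z≤n
indicator-pair {false} {true}  _        = s≤s z≤n
indicator-pair {false} {false} (inj₁ ())
indicator-pair {false} {false} (inj₂ ())

count-pairs : ∀ S m → (∀ j → j < m → S (left j) ≡ true ⊎ S (right j) ≡ true) →
              m ≤ count S (left m)
count-pairs S zero    hit = z≤n
count-pairs S (suc m) hit = begin
  suc m                                             ≡⟨ +-comm 1 m ⟩
  m + 1                                             ≤⟨ +-mono-≤ earlier-pairs (indicator-pair (hit m ≤-refl)) ⟩
  count S (left m) + (bit (left m) + bit (right m)) ≡⟨ sym (+-assoc (count S (left m)) _ _) ⟩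
  count S (left (suc m))                            ∎
  where
    open ≤-Reasoning
    bit : ℕ → ℕ
    bit x = if S x then 1 else 0
    earlier-pairs : m ≤ count S (left m)
    earlier-pairs = count-pairs S m (λ j j<m → hit j (m<n⇒m<1+n j<m))

count-even-left : ∀ m → count even (left m) ≡ m
count-even-left zero = refl
count-even-left (suc m)
  rewrite even-left m | even-right m | count-even-left m = trans (+-identityʳ (m + 1)) (+-comm m 1)

Edge-ordered : ∀ {n} {h : History n} {u v} → Edge h u v → u < v
Edge-ordered (old e)   = Edge-ordered e
Edge-ordered (new i _) = toℕ<n i

Edge-bounded : ∀ {n} {h : History n} {u v} → Edge h u v → v < n
Edge-bounded (old e)   = m<n⇒m<1+n (Edge-bounded e)
Edge-bounded (new i _) = ≤-refl

neighbour∈cover : ∀ {n} {h : History n} {C u w} → IsVertexCover h C →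
                  C w ≢ true → Edge h u w → C u ≡ true
neighbour∈cover cover w∉C e = [ id , (λ w∈C → contradiction w∈C w∉C) ]′ (cover _ _ e)

isolated-edge∈maximal : ∀ {n} {h : History n} {M u v} → IsMaximalMatching h M → Edge h u v →
                        (∀ {a b} → Edge h a b → Incident u (a , b) ⊎ Incident v (a , b) →
                                   (a , b) ≡ (u , v)) →
                        (u , v) ∈ M
isolated-edge∈maximal {M = M} ((edges , _) , maximal) uv isolated with maximal _ _ uv
... | inj₁ ((a , b) , ab∈M , u∼ab) = subst (_∈ M) (isolated (edges a b ab∈M) (inj₁ u∼ab)) ab∈M
... | inj₂ ((a , b) , ab∈M , v∼ab) = subst (_∈ M) (isolated (edges a b ab∈M) (inj₂ v∼ab)) ab∈M

-- An edge of M at the new vertex n is some {i, n}; the matching edge of M₀ at i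
-- is an older edge, so it differs from {i, n} while sharing the endpoint i.
new-vertex-unsaturated : ∀ {n} {h : History n} {N M₀ M} → IsMatching h M₀ →
                         (∀ {e} → e ∈ M₀ → e ∈ M) → IsMatching (h ▸ N) M →
                         (∀ i → i ∈ N → Saturated M₀ (toℕ i)) → ¬ Saturated M n
new-vertex-unsaturated {n} (edges₀ , _) M₀⊆M (edges , disjoint) N-saturated ((a , b) , ab∈M , n∼ab)
  with edges a b ab∈M
... | old e = [ (λ n≡a → <-irrefl (sym n≡a) (<-trans (Edge-ordered e) (Edge-bounded e)))
              , (λ n≡b → <-irrefl (sym n≡b) (Edge-bounded e)) ]′ n∼ab
... | new i i∈N with N-saturated i i∈N
...   | ((c , d) , cd∈M₀ , i∼cd) =
  <-irrefl (cong proj₂ (disjoint _ _ (toℕ i) (M₀⊆M cd∈M₀) ab∈M i∼cd (inj₁ refl)))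
           (Edge-bounded (edges₀ c d cd∈M₀))

pairs : (m : ℕ) → History (left m)
pairs zero    = ε
pairs (suc m) = pairs m ▸ [] ▸ (fromℕ (left m) ∷ [])

pairs-edge : ∀ m j → j < m → Edge (pairs m) (left j) (right j)
pairs-edge (suc m) j j<1+m with m<1+n⇒m<n∨m≡n j<1+m
... | inj₁ j<m  = old (old (pairs-edge m j j<m))
... | inj₂ refl = subst (λ x → Edge (pairs (suc j)) x (right j)) (toℕ-fromℕ (left j))
                        (new (fromℕ (left j)) (here refl))

pairs-edge⁻¹ : ∀ m {u v} → Edge (pairs m) u v → Σ ℕ λ j → j < m × u ≡ left j × v ≡ right j
pairs-edge⁻¹ (suc m) (old (old e)) with pairs-edge⁻¹ m e
... | j , j<m , u≡ , v≡ = j , m<n⇒m<1+n j<m , u≡ , v≡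
pairs-edge⁻¹ (suc m) (new i (here refl)) = m , ≤-refl , toℕ-fromℕ (left m) , refl

pairs-isolated : ∀ m j {a b} → Edge (pairs m) a b →
                 Incident (left j) (a , b) ⊎ Incident (right j) (a , b) →
                 (a , b) ≡ (left j , right j)
pairs-isolated m j ab ends with pairs-edge⁻¹ m ab
... | j′ , _ , refl , refl with [ (λ l → incident-pair-unique l (inj₁ refl))
                                , (λ r → incident-pair-unique r (inj₂ refl)) ]′ ends
...   | refl = refl

<left⇒in-pair : ∀ m x → x < left m → Σ ℕ λ j → j < m × Incident x (left j , right j)
<left⇒in-pair (suc m) x x<2+2m with m<1+n⇒m<n∨m≡n x<2+2m
... | inj₂ x≡right = m , ≤-refl , inj₂ x≡right
... | inj₁ x<1+2m with m<1+n⇒m<n∨m≡n x<1+2m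
...   | inj₂ x≡left = m , ≤-refl , inj₁ x≡left
...   | inj₁ x<2m with <left⇒in-pair m x x<2m
...     | j , j<m , x∼j = j , m<n⇒m<1+n j<m , x∼j

star : (m : ℕ) → History (suc (left m))
star m = pairs m ▸ allFin (left m)

star-edge : ∀ m {x} → x < left m → Edge (star m) x (left m)
star-edge m x<2m = subst (λ y → Edge (star m) y (left m)) (toℕ-fromℕ< x<2m)
                         (new (fromℕ< x<2m) (∈-allFin _))

even-covers-star : ∀ m → IsVertexCover (star m) even
even-covers-star m u v (old e) with pairs-edge⁻¹ m e
... | j , _ , refl , refl = inj₁ (even-left j)
even-covers-star m u v (new i _) = inj₂ (even-left m)

count-even-star : ∀ m → count even (suc (left m)) ≡ suc m
count-even-star m rewrite count-even-left m | even-left m = +-comm m 1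

-- With m ≥ 1: a cover either contains the centre plus one endpoint of each of
-- the m pairs, or misses the centre and so contains all 2m ≥ m + 1 leaves.
star-cover-size : ∀ k {C} → IsVertexCover (star (suc k)) C →
                  suc (suc k) ≤ count C (suc (left (suc k)))
star-cover-size k {C} cover with C (left (suc k)) in centre
... | true = begin
  suc (suc k)                  ≤⟨ s≤s (count-pairs C (suc k) covers-pair) ⟩
  suc (count C (left (suc k))) ≡⟨ +-comm 1 _ ⟩
  count C (left (suc k)) + 1   ∎
  where
    open ≤-Reasoning
    covers-pair : ∀ j → j < suc k → C (left j) ≡ true ⊎ C (right j) ≡ true
    covers-pair j j<m = cover _ _ (old (pairs-edge (suc k) j j<m))
... | false = begin
  suc (suc k)                ≤⟨ s≤s (s≤s (n≤left k)) ⟩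
  left (suc k)               ≡⟨ sym (count-all C (left (suc k)) leaves∈C) ⟩
  count C (left (suc k))     ≤⟨ m≤m+n _ 0 ⟩
  count C (left (suc k)) + 0 ∎
  where
    open ≤-Reasoning
    leaves∈C : ∀ x → x < left (suc k) → C x ≡ true
    leaves∈C x x<2m = neighbour∈cover cover centre∉C (star-edge (suc k) x<2m)
      where
        centre∉C : C (left (suc k)) ≢ true
        centre∉C centre∈C = contradiction (trans (sym centre) centre∈C) λ ()

star-opt : ∀ k → IsMinVCSize (star (suc k)) (suc (suc k))
star-opt k = (even , even-covers-star (suc k) , count-even-star (suc k))
           , λ _ → star-cover-size k

module _ (A : OnlineAlgorithm) (I : IncrementalMatchingBased A) where
  open OnlineAlgorithm A
  open IncrementalMatchingBased I

  pairs-matched : ∀ m j → j < m → (left j , right j) ∈ matching (pairs m)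
  pairs-matched (suc m) j j<1+m with m<1+n⇒m<n∨m≡n j<1+m
  ... | inj₁ j<m  = incremental _ _ _ (incremental _ _ _ (pairs-matched m j j<m))
  ... | inj₂ refl = isolated-edge∈maximal (maximal (pairs (suc j))) (pairs-edge (suc j) j ≤-refl)
                                          (pairs-isolated (suc j) j)

  centre-unsaturated : ∀ m → ¬ Saturated (matching (star m)) (left m)
  centre-unsaturated m =
    new-vertex-unsaturated (proj₁ (maximal (pairs m))) (incremental _ _ _)
                           (proj₁ (maximal (star m))) leaf-saturated
    where
      leaf-saturated : ∀ i → i ∈ allFin (left m) → Saturated (matching (pairs m)) (toℕ i)
      leaf-saturated i _ with <left⇒in-pair m (toℕ i) (toℕ<n i)
      ... | j , j<m , i∼j = (left j , right j) , pairs-matched m j j<m , i∼j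

  leaves∈solution : ∀ m x → x < left m → solution (star m) x ≡ true
  leaves∈solution m x x<2m =
    neighbour∈cover (covers (star m)) (λ centre∈S → centre-unsaturated m (saturatedOnly _ _ centre∈S))
                    (star-edge m x<2m)

mainTheorem17 : (A : OnlineAlgorithm) → IncrementalMatchingBased A →
    (k : ℕ) → Σ ℕ λ n → Σ (History n) λ h → Σ ℕ λ opt →
      IsMinVCSize h opt × k ≤ opt ×
      2 * opt ≤ count (OnlineAlgorithm.solution A h) n + 2
mainTheorem17 A I k = suc (left m) , star m , suc m , star-opt k , m≤n⇒m≤1+n (n≤1+n k) , ratio
  where
    open ≤-Reasoning
    m : ℕ
    m = suc k
    S : ℕ → Bool
    S = OnlineAlgorithm.solution A (star m)
    ratio : 2 * suc m ≤ count S (suc (left m)) + 2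
    ratio = begin
      2 * suc m                    ≡⟨ sym (left≡2* (suc m)) ⟩
      2 + left m                   ≡⟨ cong (2 +_) (sym (count-all S (left m) (leaves∈solution A I m))) ⟩
      2 + count S (left m)         ≤⟨ +-monoʳ-≤ 2 (count-≤-suc S (left m)) ⟩
      2 + count S (suc (left m))   ≡⟨ +-comm 2 _ ⟩
      count S (suc (left m)) + 2   ∎
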